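{- For every integer $k\ge 2$ and $n=6k$, there is no balanced sequence of $n$ permutations of $[n]$; that is, there are no assignments $\sigma_1,\ldots,\sigma_n$ (bijections from a set $N$ of $n$ players to $[n]$) such that $Z_i^t[j]\le\lceil jn/t\rceil$ for all $t\in[n]$, all $j\in[t]$ and all $i\in N$.
   Context: There are $n$ players $N$ and $n$ items $[n]=\{1,\ldots,n\}$, item $1$ being the best. A permutation sequence is a sequence of bijections $\sigma_1,\sigma_2,\ldots$ from $N$ to $[n]$, $\sigma_s$ being the assignment on day $s$. The bundle of player $i$ after day $t$ is the multiset $Z_i^t=\{\sigma_1(i),\ldots,\sigma_t(i)\}$. For a multiset $Z$ and $k\le|Z|$, $Z[k]$ is the $k$-th smallest number in $Z$ (counted with multiplicity). A sequence of $n$ assignments is balanced if for every day $t\in[n]$, every $j\in[t]$ and every player $i$: $Z_i^t[j]\le\lceil jn/t\rceil$. -}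

module Defs where

open import Data.Nat using (ℕ; zero; suc; _+_; _*_; _∸_; _≤_; _/_)
open import Data.Nat.Properties using (≤-decTotalOrder)
open import Data.Fin using (Fin; toℕ)
open import Data.List using (List; []; _∷_; map; take; allFin)
open import Data.Fin.Permutation using (Permutation′; _⟨$⟩ʳ_)
import Data.List.Sort.InsertionSort.Base as ISort

sortℕ : List ℕ → List ℕ
sortℕ = ISort.sort ≤-decTotalOrder

-- Z[k] : the k-th smallest element (1-indexed) of a multiset given as a
-- list, counted with multiplicity.  Only used for 1 ≤ k ≤ length, where
-- the fallback value 0 is never reached.
nth : List ℕ → ℕ → ℕ
nth []       _             = 0
nth (x ∷ xs) zero          = 0
nth (x ∷ xs) (suc zero)    = x
nth (x ∷ xs) (suc (suc k)) = nth xs (suc k)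

kthSmallest : List ℕ → ℕ → ℕ
kthSmallest Z k = nth (sortℕ Z) k

-- Ceiling division ⌈ a / t ⌉ for t ≥ 1 (value at t = 0 irrelevant).
ceilDiv : ℕ → ℕ → ℕ
ceilDiv a zero    = 0
ceilDiv a (suc t) = (a + t) / suc t

-- Players are Fin n; items are [n] = {1,…,n}, where item (toℕ x + 1)
-- corresponds to x : Fin n.  A sequence of n assignments is
-- σ : Fin n → Permutation′ n, where σ s is the assignment on day (toℕ s + 1).
PermSeq : ℕ → Set
PermSeq n = Fin n → Permutation′ n

item : ∀ {n} → Permutation′ n → Fin n → ℕ
item π i = suc (toℕ (π ⟨$⟩ʳ i))

bundle : ∀ {n} → PermSeq n → Fin n → ℕ → List ℕ
bundle {n} σ i t = map (λ s → item (σ s) i) (take t (allFin n))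

Balanced : ∀ {n} → PermSeq n → Set
Balanced {n} σ =
  ∀ (t : ℕ) → 1 ≤ t → t ≤ n →
  ∀ (j : ℕ) → 1 ≤ j → j ≤ t →
  ∀ (i : Fin n) → kthSmallest (bundle σ i t) j ≤ ceilDiv (j * n) t

module Submission where

-- Write x₀, x₁, x₂, x₃ for a player's items on the first four days and m = ⌈n/4⌉,
-- c = ⌈n/3⌉, e = ⌈n/2⌉ = ⌈2n/4⌉.  Balance on days 2, 3, 4 forces, for every player,
--   3 ≤ [x₂ ≤ m] + #{x₀, x₁ ≤ c} + #{x₀, …, x₃ ≤ e}:
-- the last term is at least 2, and if the first two vanish then x₂ is the player's item ≤ c
-- among days 1–3, x₃ its item ≤ m among days 1–4, and one of x₀, x₁ is ≤ e.
-- Since each day is a permutation, at most v players receive an item ≤ v on a given day, so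
-- summing over players gives 3n ≤ m + 2c + 4e.  For n = 6k this says 2k ≤ ⌈3k/2⌉,
-- false for k ≥ 2.

open import Defs
open import Data.Nat using (ℕ; zero; suc; _+_; _*_; _∸_; _⊓_; _/_; _≤_; _<_; z≤n; s≤s)
open import Data.Nat.DivMod using (+-distrib-/-∣ˡ; m*n/n≡m; m<n⇒m/n≡0; m/n*n≤m)
open import Data.Nat.Divisibility using (n∣m*n)
open import Data.Nat.Properties
open import Data.Fin using (Fin; toℕ) renaming (zero to fzero; suc to fsuc)
open import Data.List using (List; []; _∷_; [_]; _++_; length; filter; map; take; allFin)
open import Data.List.Properties using (length-++; filter-++; filter-accept; filter-reject; length-map; length-take; length-tabulate)
open import Data.List.Relation.Unary.Linked using (Linked; _∷_)
import Data.List.Relation.Unary.Linked as Linked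
open import Data.List.Relation.Binary.Permutation.Propositional using (_↭_)
open import Data.List.Relation.Binary.Permutation.Propositional.Properties using (↭-length; filter-↭)
open import Data.List.Sort.InsertionSort.Properties ≤-decTotalOrder using (sort-↭; sort-↗)
open import Data.Fin.Patterns using (0F; 1F; 2F; 3F)
open import Data.Fin.Permutation using (Permutation′)
open import Algebra.Properties.CommutativeMonoid.Sum +-0-commutativeMonoid using (sum; sum-cong-≗; ∑-distrib-+; sum-permute; sum-replicate-zero)
open import Data.Product using (Σ; proj₁; proj₂)
open import Data.Empty using (⊥)
open import Data.Nat.Tactic.RingSolver using (solve)
open import Function using (_∘_)
open import Relation.Binary.PropositionalEquality using (_≡_; refl; sym; trans; cong; cong₂; subst; module ≡-Reasoning)
open import Relation.Nullary using (¬_; yes; no)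

count≤ : ℕ → List ℕ → ℕ
count≤ v = length ∘ filter (_≤? v)

count≤-accept : ∀ {v x} xs → x ≤ v → count≤ v (x ∷ xs) ≡ suc (count≤ v xs)
count≤-accept xs x≤v = cong length (filter-accept (_≤? _) x≤v)

count≤-reject : ∀ {v x} xs → v < x → count≤ v (x ∷ xs) ≡ count≤ v xs
count≤-reject xs v<x = cong length (filter-reject (_≤? _) (<⇒≱ v<x))

count≤-++ : ∀ v xs ys → count≤ v (xs ++ ys) ≡ count≤ v xs + count≤ v ys
count≤-++ v xs ys = trans (cong length (filter-++ (_≤? v) xs ys)) (length-++ (filter (_≤? v) xs))

count≤-↭ : ∀ v {xs ys} → xs ↭ ys → count≤ v xs ≡ count≤ v ys
count≤-↭ v = ↭-length ∘ filter-↭ (_≤? v)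

≤⇒1≤count≤ : ∀ {v x xs} → x ≤ v → 1 ≤ count≤ v (x ∷ xs)
≤⇒1≤count≤ x≤v = subst (1 ≤_) (sym (count≤-accept _ x≤v)) (s≤s z≤n)

count≤-suc : ∀ {v} x → count≤ (suc v) (suc x ∷ []) ≡ count≤ v (x ∷ [])
count≤-suc {v} x with x ≤? v
... | yes x≤v = trans (count≤-accept [] (s≤s x≤v)) (sym (count≤-accept [] x≤v))
... | no  x≰v = trans (count≤-reject [] (s≤s (≰⇒> x≰v))) (sym (count≤-reject [] (≰⇒> x≰v)))

1≤count≤⇒≤ : ∀ {v x} → 1 ≤ count≤ v (x ∷ []) → x ≤ v
1≤count≤⇒≤ {v} {x} pos with x ≤? v
... | yes x≤v = x≤v
... | no  x≰v with () ← subst (1 ≤_) (count≤-reject [] (≰⇒> x≰v)) pos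

head≤nth : ∀ {x xs} j → Linked _≤_ (x ∷ xs) → j ≤ length xs → x ≤ nth (x ∷ xs) (suc j)
head≤nth zero    _                _         = ≤-refl
head≤nth (suc j) (x≤y ∷ sorted) (s≤s j≤) = ≤-trans x≤y (head≤nth j sorted j≤)

sorted-nth≤⇒count≤ : ∀ {b} xs j → Linked _≤_ xs → j < length xs → nth xs (suc j) ≤ b →
                     suc j ≤ count≤ b xs
sorted-nth≤⇒count≤ (x ∷ xs) zero    _      _       x≤b   = ≤⇒1≤count≤ x≤b
sorted-nth≤⇒count≤ (x ∷ xs) (suc j) sorted (s≤s j<) nth≤b =
  subst (suc (suc j) ≤_) (sym (count≤-accept xs (≤-trans (head≤nth (suc j) sorted j<) nth≤b)))
    (s≤s (sorted-nth≤⇒count≤ xs j (Linked.tail sorted) j< nth≤b))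

kthSmallest≤⇒count≤ : ∀ {b} xs j → j < length xs → kthSmallest xs (suc j) ≤ b →
                      suc j ≤ count≤ b xs
kthSmallest≤⇒count≤ {b} xs j j< kth≤b =
  subst (suc j ≤_) (count≤-↭ b (sort-↭ xs))
    (sorted-nth≤⇒count≤ (sortℕ xs) j (sort-↗ xs)
      (subst (j <_) (sym (↭-length (sort-↭ xs))) j<) kth≤b)

three≤count≤ : ∀ {m c e x₀ x₁ x₂ x₃} → c ≤ e → c < x₀ → c < x₁ → m < x₂ →
  1 ≤ count≤ e (x₀ ∷ x₁ ∷ []) →
  1 ≤ count≤ c (x₀ ∷ x₁ ∷ x₂ ∷ []) →
  1 ≤ count≤ m (x₀ ∷ x₁ ∷ x₂ ∷ x₃ ∷ []) →
  3 ≤ count≤ e (x₀ ∷ x₁ ∷ x₂ ∷ x₃ ∷ [])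
three≤count≤ {m} {c} {e} {x₀} {x₁} {x₂} {x₃} c≤e c<x₀ c<x₁ m<x₂ e₂ c₃ m₄ = begin
  1 + 2                                                  ≤⟨ +-monoˡ-≤ 2 e₂ ⟩
  count≤ e (x₀ ∷ x₁ ∷ []) + 2                            ≡⟨ cong (count≤ e (x₀ ∷ x₁ ∷ []) +_) x₂x₃≤e ⟨
  count≤ e (x₀ ∷ x₁ ∷ []) + count≤ e (x₂ ∷ x₃ ∷ [])     ≡⟨ count≤-++ e (x₀ ∷ x₁ ∷ []) (x₂ ∷ x₃ ∷ []) ⟨
  count≤ e (x₀ ∷ x₁ ∷ x₂ ∷ x₃ ∷ [])                     ∎
  where
  open ≤-Reasoning
  x₂≤c : x₂ ≤ c
  x₂≤c = 1≤count≤⇒≤ (subst (1 ≤_) (trans (count≤-reject _ c<x₀) (count≤-reject _ c<x₁)) c₃)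
  m<x : ∀ {x} → c < x → m < x
  m<x c<x = <-trans m<x₂ (≤-<-trans x₂≤c c<x)
  x₃≤m : x₃ ≤ m
  x₃≤m = 1≤count≤⇒≤ (subst (1 ≤_)
    (trans (count≤-reject _ (m<x c<x₀)) (trans (count≤-reject _ (m<x c<x₁)) (count≤-reject _ m<x₂))) m₄)
  x₂x₃≤e : count≤ e (x₂ ∷ x₃ ∷ []) ≡ 2
  x₂x₃≤e = trans (count≤-accept _ (≤-trans x₂≤c c≤e))
                 (cong suc (count≤-accept [] (≤-trans x₃≤m (≤-trans (<⇒≤ m<x₂) (≤-trans x₂≤c c≤e)))))

three≤count≤-sum : ∀ {m c e x₀ x₁ x₂ x₃} → c ≤ e →
  1 ≤ count≤ e (x₀ ∷ x₁ ∷ []) →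
  1 ≤ count≤ c (x₀ ∷ x₁ ∷ x₂ ∷ []) →
  1 ≤ count≤ m (x₀ ∷ x₁ ∷ x₂ ∷ x₃ ∷ []) →
  2 ≤ count≤ e (x₀ ∷ x₁ ∷ x₂ ∷ x₃ ∷ []) →
  3 ≤ count≤ m (x₂ ∷ []) + count≤ c (x₀ ∷ x₁ ∷ []) + count≤ e (x₀ ∷ x₁ ∷ x₂ ∷ x₃ ∷ [])
three≤count≤-sum {m = m} {c = c} {x₀ = x₀} {x₁ = x₁} {x₂ = x₂} c≤e e₂ c₃ m₄ e₄
  with x₀ ≤? c | x₁ ≤? c | x₂ ≤? m
... | yes x₀≤c | _        | _        = +-mono-≤ (≤-trans (≤⇒1≤count≤ x₀≤c) (m≤n+m _ _)) e₄
... | no x₀≰c  | yes x₁≤c | _        =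
  +-mono-≤ (≤-trans (subst (1 ≤_) (sym (count≤-reject _ (≰⇒> x₀≰c))) (≤⇒1≤count≤ x₁≤c)) (m≤n+m _ _)) e₄
... | no _     | no _     | yes x₂≤m = +-mono-≤ (≤-trans (≤⇒1≤count≤ x₂≤m) (m≤m+n _ _)) e₄
... | no x₀≰c  | no x₁≰c  | no x₂≰m  =
  ≤-trans (three≤count≤ c≤e (≰⇒> x₀≰c) (≰⇒> x₁≰c) (≰⇒> x₂≰m) e₂ c₃ m₄) (m≤n+m _ _)

∑-const : ∀ n c → sum {n} (λ _ → c) ≡ n * c
∑-const zero    c = refl
∑-const (suc n) c = cong (c +_) (∑-const n c)

∑-mono-≤ : ∀ {n} {f g : Fin n → ℕ} → (∀ i → f i ≤ g i) → sum f ≤ sum g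
∑-mono-≤ {zero}  _   = z≤n
∑-mono-≤ {suc n} f≤g = +-mono-≤ (f≤g fzero) (∑-mono-≤ (f≤g ∘ fsuc))

∑-count≤-ranks : ∀ n v → sum {n} (λ r → count≤ v (suc (toℕ r) ∷ [])) ≡ n ⊓ v
∑-count≤-ranks zero    v       = refl
∑-count≤-ranks (suc n) zero    = sum-replicate-zero n
∑-count≤-ranks (suc n) (suc v) =
  cong suc (trans (sum-cong-≗ {n} (λ r → count≤-suc {v} (suc (toℕ r)))) (∑-count≤-ranks n v))

∑-count≤-item : ∀ {n} (π : Permutation′ n) v → sum (λ i → count≤ v (item π i ∷ [])) ≡ n ⊓ v
∑-count≤-item {n} π v =
  trans (sym (sum-permute (λ r → count≤ v (suc (toℕ r) ∷ [])) π)) (∑-count≤-ranks n v)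

received : ∀ {n} → PermSeq n → List (Fin n) → Fin n → List ℕ
received σ ds i = map (λ s → item (σ s) i) ds

∑-count≤-received : ∀ {n} (σ : PermSeq n) v ds →
                    sum (λ i → count≤ v (received σ ds i)) ≡ length ds * (n ⊓ v)
∑-count≤-received {n} σ v []       = sum-replicate-zero n
∑-count≤-received {n} σ v (d ∷ ds) = begin
  sum (λ i → count≤ v (received σ (d ∷ ds) i))          ≡⟨ sum-cong-≗ {n} (λ i → count≤-++ v (item (σ d) i ∷ []) _) ⟩
  sum (λ i → count≤ v (item (σ d) i ∷ []) + later i)     ≡⟨ ∑-distrib-+ (λ i → count≤ v (item (σ d) i ∷ [])) later ⟩
  sum (λ i → count≤ v (item (σ d) i ∷ [])) + sum later   ≡⟨ cong₂ _+_ (∑-count≤-item (σ d) v) (∑-count≤-received σ v ds) ⟩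
  n ⊓ v + length ds * (n ⊓ v)                            ∎
  where
  open ≡-Reasoning
  later : Fin n → ℕ
  later i = count≤ v (received σ ds i)

length-take-allFin : ∀ {n t} → t ≤ n → length (take t (allFin n)) ≡ t
length-take-allFin {n} {t} t≤n = begin
  length (take t (allFin n))   ≡⟨ length-take t (allFin n) ⟩
  t ⊓ length (allFin n)        ≡⟨ cong (t ⊓_) (length-tabulate _) ⟩
  t ⊓ n                        ≡⟨ m≤n⇒m⊓n≡m t≤n ⟩
  t                            ∎
  where open ≡-Reasoning

∑-count≤-bundle : ∀ {n} (σ : PermSeq n) v {t} → t ≤ n →
                  sum (λ i → count≤ v (bundle σ i t)) ≡ t * (n ⊓ v)
∑-count≤-bundle {n} σ v {t} t≤n =
  trans (∑-count≤-received σ v (take t (allFin n))) (cong (_* (n ⊓ v)) (length-take-allFin t≤n))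

balanced⇒count≤ : ∀ {n} {σ : PermSeq n} → Balanced σ → ∀ {t} j → j < t → t ≤ n → ∀ i →
                  suc j ≤ count≤ (ceilDiv (suc j * n) t) (bundle σ i t)
balanced⇒count≤ {σ = σ} balanced {t} j j<t t≤n i =
  kthSmallest≤⇒count≤ (bundle σ i t) j
    (subst (j <_) (sym (trans (length-map _ (take t (allFin _))) (length-take-allFin t≤n))) j<t)
    (balanced t (≤-trans (s≤s z≤n) j<t) t≤n (suc j) (s≤s z≤n) j<t i)

ceilDiv-exact : ∀ {a} q d → a ≡ q * suc d → ceilDiv a (suc d) ≡ q
ceilDiv-exact {a} q d refl = begin
  (q * suc d + d) / suc d         ≡⟨ +-distrib-/-∣ˡ d (n∣m*n q) ⟩
  q * suc d / suc d + d / suc d   ≡⟨ cong₂ _+_ (m*n/n≡m q (suc d)) (m<n⇒m/n≡0 {d} ≤-refl) ⟩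
  q + 0                           ≡⟨ +-identityʳ q ⟩
  q ∎
  where open ≡-Reasoning

-- With 4 + n players the bundles of the first four days compute to explicit lists.
balanced⇒bound : ∀ {n m c e} (σ : PermSeq (4 + n)) → Balanced σ →
  ceilDiv (1 * (4 + n)) 4 ≡ m → ceilDiv (1 * (4 + n)) 3 ≡ c →
  ceilDiv (1 * (4 + n)) 2 ≡ e → ceilDiv (2 * (4 + n)) 4 ≡ e → c ≤ e →
  (4 + n) * 3 ≤ m + 2 * c + 4 * e
balanced⇒bound {n} {m} {c} {e} σ balanced m≡ c≡ e₂≡ e₄≡ c≤e = begin
  (4 + n) * 3                                              ≡⟨ ∑-const (4 + n) 3 ⟨
  sum (λ (_ : Fin N) → 3)                                  ≤⟨ ∑-mono-≤ player ⟩
  sum (λ i → day₃ i + first₂ i + first₄ i)                 ≡⟨ ∑-distrib-+ (λ i → day₃ i + first₂ i) first₄ ⟩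
  sum (λ i → day₃ i + first₂ i) + sum first₄               ≡⟨ cong (_+ sum first₄) (∑-distrib-+ day₃ first₂) ⟩
  sum day₃ + sum first₂ + sum first₄                       ≡⟨ cong₂ _+_ (cong₂ _+_ (∑-count≤-item (σ 2F) m) (∑-count≤-bundle σ c 2≤N))
                                                                          (∑-count≤-bundle σ e 4≤N) ⟩
  N ⊓ m + 2 * (N ⊓ c) + 4 * (N ⊓ e)                        ≤⟨ +-mono-≤ (+-mono-≤ (m⊓n≤n N m) (*-monoʳ-≤ 2 (m⊓n≤n N c))) (*-monoʳ-≤ 4 (m⊓n≤n N e)) ⟩
  m + 2 * c + 4 * e ∎
  where
  open ≤-Reasoning
  N : ℕ
  N = 4 + n
  day₃ first₂ first₄ : Fin N → ℕ
  day₃   i = count≤ m (item (σ 2F) i ∷ [])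
  first₂ i = count≤ c (bundle σ i 2)
  first₄ i = count≤ e (bundle σ i 4)
  4≤N : 4 ≤ N
  4≤N = m≤m+n 4 n
  3≤N : 3 ≤ N
  3≤N = ≤-trans (n≤1+n 3) 4≤N
  2≤N : 2 ≤ N
  2≤N = ≤-trans (n≤1+n 2) 3≤N
  player : ∀ i → 3 ≤ day₃ i + first₂ i + first₄ i
  player i = three≤count≤-sum {m} {c} {e} {x 0F} {x 1F} {x 2F} {x 3F} c≤e
    (demand 0 0<1+n 2≤N e₂≡) (demand 0 0<1+n 3≤N c≡) (demand 0 0<1+n 4≤N m≡) (demand 1 (s≤s 0<1+n) 4≤N e₄≡)
    where
    x : Fin N → ℕ
    x s = item (σ s) i
    demand : ∀ {t} j → j < t → t ≤ N → ∀ {v} → ceilDiv (suc j * N) t ≡ v → suc j ≤ count≤ v (bundle σ i t)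
    demand j j<t t≤N refl = balanced⇒count≤ {σ = σ} balanced j j<t t≤N i

no-room : ∀ k m → 2 ≤ k → 6 * k * 3 ≤ m + 2 * (2 * k) + 4 * (3 * k) → m * 4 ≤ 1 * (6 * k) + 3 → ⊥
no-room k m 2≤k bound m*4≤ = <⇒≱ (n<1+n 3) (+-cancelˡ-≤ (6 * k) 4 3 (begin
  6 * k + 2 * 2      ≤⟨ +-monoʳ-≤ (6 * k) (*-monoʳ-≤ 2 2≤k) ⟩
  6 * k + 2 * k      ≡⟨ 6k+2k≡2k*4 ⟩
  2 * k * 4          ≤⟨ *-monoˡ-≤ 4 2k≤m ⟩
  m * 4              ≤⟨ m*4≤ ⟩
  1 * (6 * k) + 3    ≡⟨ cong (_+ 3) (*-identityˡ (6 * k)) ⟩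
  6 * k + 3          ∎))
  where
  open ≤-Reasoning
  6k+2k≡2k*4 : 6 * k + 2 * k ≡ 2 * k * 4
  6k+2k≡2k*4 = solve [ k ]
  2k+16k≡6k*3 : 2 * k + (2 * (2 * k) + 4 * (3 * k)) ≡ 6 * k * 3
  2k+16k≡6k*3 = solve [ k ]
  2k≤m : 2 * k ≤ m
  2k≤m = +-cancelʳ-≤ (2 * (2 * k) + 4 * (3 * k)) (2 * k) m (begin
    2 * k + (2 * (2 * k) + 4 * (3 * k))   ≡⟨ 2k+16k≡6k*3 ⟩
    6 * k * 3                             ≤⟨ bound ⟩
    m + 2 * (2 * k) + 4 * (3 * k)         ≡⟨ +-assoc m _ _ ⟩
    m + (2 * (2 * k) + 4 * (3 * k))       ∎)

no-balanced-6k : ∀ {n} k → 2 ≤ k → 4 + n ≡ 6 * k → (σ : PermSeq (4 + n)) → ¬ Balanced σ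
no-balanced-6k {n} k 2≤k N≡6k σ balanced = no-room k m 2≤k
  (subst (λ N → N * 3 ≤ m + 2 * (2 * k) + 4 * (3 * k)) N≡6k
    (balanced⇒bound σ balanced refl
      (ceilDiv-6k 1 (2 * k) 2 6k≡2k*3) (ceilDiv-6k 1 (3 * k) 1 6k≡3k*2) (ceilDiv-6k 2 (3 * k) 3 12k≡3k*4)
      (*-monoˡ-≤ k (n≤1+n 2))))
  (subst (λ N → m * 4 ≤ 1 * N + 3) N≡6k (m/n*n≤m (1 * (4 + n) + 3) 4))
  where
  m : ℕ
  m = ceilDiv (1 * (4 + n)) 4
  ceilDiv-6k : ∀ j q d → j * (6 * k) ≡ q * suc d → ceilDiv (j * (4 + n)) (suc d) ≡ q
  ceilDiv-6k j q d eq = ceilDiv-exact q d (trans (cong (j *_) N≡6k) eq)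
  6k≡2k*3 : 1 * (6 * k) ≡ 2 * k * 3
  6k≡2k*3 = solve [ k ]
  6k≡3k*2 : 1 * (6 * k) ≡ 3 * k * 2
  6k≡3k*2 = solve [ k ]
  12k≡3k*4 : 2 * (6 * k) ≡ 3 * k * 4
  12k≡3k*4 = solve [ k ]

proposition2 : (k : ℕ) → 2 ≤ k → ¬ (Σ (PermSeq (6 * k)) Balanced)
proposition2 k 2≤k σ-balanced = no-balanced-6k k 2≤k N≡6k (proj₁ transported) (proj₂ transported)
  where
  N≡6k : 4 + (6 * k ∸ 4) ≡ 6 * k
  N≡6k = m+[n∸m]≡n (≤-trans (m≤m+n 4 8) (*-monoʳ-≤ 6 2≤k))
  transported : Σ (PermSeq (4 + (6 * k ∸ 4))) Balanced
  transported = subst (λ N → Σ (PermSeq N) Balanced) (sym N≡6k) σ-balanced
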